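{- Assume Cramér's conjecture: there exist constants $M$ and $N$ such that, denoting by $p_i$ the $i$-th prime, $p_{i+1}-p_i\le M(\log p_i)^2$ whenever $p_i\ge N$. Then for every positive integer $m$ there is $n_0$ such that every integer $n\ge n_0$ with exactly $m$ distinct prime factors satisfies Condition 1, i.e. there exist primes $p,q$ such that for every $k$ with $1\le k\le n-1$, $\binom{n}{k}$ is divisible by $p$ or by $q$. -}

module Defs where

open import Data.Nat using (ℕ; suc; _+_; _*_; _∸_; _^_; _≤_; _<_)
open import Data.Nat.Divisibility using (_∣_; _∣?_)
open import Data.Nat.Primality using (Prime; prime?)
open import Data.Nat.Logarithm using (⌈log₂_⌉)
open import Data.Nat.Combinatorics using (_C_)
open import Data.List using (length; filter; upTo)
open import Data.Product using (_×_; ∃₂)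
open import Data.Sum using (_⊎_)
open import Relation.Nullary.Decidable using (_×-dec_)
open import Relation.Binary.PropositionalEquality using (_≡_)

ω : ℕ → ℕ
ω n = length (filter (λ p → prime? p ×-dec p ∣? n) (upTo (suc n)))

ConsecutivePrimes : ℕ → ℕ → Set
ConsecutivePrimes p q =
  Prime p × Prime q × p < q × (∀ r → p < r → r < q → Prime r → Data.Empty.⊥)
  where import Data.Empty

-- Cramér's conjecture: ∃ M N, p_{i+1} - p_i ≤ M (log p_i)^2 whenever p_i ≥ N.
-- Logarithm base and real constants are absorbed into the natural constant M
--; we use ⌈log₂ p⌉.
CramerConjecture : Set
CramerConjecture =
  ∃₂ λ (M N : ℕ) → ∀ p q → ConsecutivePrimes p q → N ≤ p →
    q ∸ p ≤ M * (⌈log₂ p ⌉ ^ 2)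

Condition1 : ℕ → Set
Condition1 n = ∃₂ λ (p q : ℕ) → Prime p × Prime q ×
  (∀ k → 1 ≤ k → k ≤ n ∸ 1 → (p ∣ n C k) ⊎ (q ∣ n C k))

-- Let n have exactly m distinct prime factors and let p ≤ n < q be the consecutive
-- primes around n. Cramér's bound gives n - p ≤ G := M ⌈log₂ n⌉². Since
-- n ≤ G ^ ω(n) whenever all prime powers dividing n are ≤ G, and G ^ m < n for
-- large n, some prime power q ^ e ∣ n exceeds G ≥ n - p. Then p and q witness
-- Condition 1: p divides C(n, k) when both k and n - k lie below p, and q divides
-- C(n, k) when k or n - k is below q ^ e (this covers k ≤ n - p and k ≥ p).
module Submission where

open import Defs
open import Data.Nat
open import Data.Nat.Properties
open import Data.Nat.Divisibility
open import Data.Nat.Primality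
open import Data.Nat.Primality.Factorisation using (factorise)
open import Data.Nat.Combinatorics
open import Data.Nat.DivMod using (m/n*n≡m)
open import Data.Nat.Logarithm using (⌈log₂_⌉; ⌈log₂⌉-mono-≤; ⌈log₂2^n⌉≡n)
open import Data.Nat.Induction using (<-wellFounded)
open import Data.Nat.ListAction using (product)
open import Data.Nat.Tactic.RingSolver using (solve-∀)
open import Induction.WellFounded using (Acc; acc)
open import Data.List using ([]; _∷_; [_]; _++_; length; filter; upTo)
open import Data.List.Properties using (upTo-∷ʳ; filter-++; filter-accept; filter-reject; length-++)
open import Data.List.Relation.Unary.All using (_∷_)
open import Data.Product
open import Function using (id)
open import Data.Sum using (_⊎_; inj₁; inj₂; [_,_]′)
open import Data.Empty using (⊥; ⊥-elim)
open import Relation.Nullary using (¬_; Dec; yes; no)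
open import Relation.Nullary.Decidable using (_×-dec_)
open import Relation.Unary using (Pred; Decidable)
open import Relation.Binary.PropositionalEquality
  using (_≡_; refl; sym; trans; cong; subst; module ≡-Reasoning)

prime≥2 : ∀ {p} → Prime p → 2 ≤ p
prime≥2 {p} p-prime = nonTrivial⇒n>1 p {{prime⇒nonTrivial p-prime}}

prime∤1 : ∀ {p} → Prime p → ¬ p ∣ 1
prime∤1 p-prime p∣1 = <⇒≱ (prime≥2 p-prime) (∣⇒≤ p∣1)

primeFactor : ∀ n → 2 ≤ n → ∃ λ p → Prime p × p ∣ n
primeFactor n@(suc _) 2≤n with factorise n
... | record { factors = [] ; isFactorisation = n≡1 } = ⊥-elim (<⇒≢ 2≤n (sym n≡1))
... | record { factors = p ∷ ps ; isFactorisation = n≡Π ; factorsPrime = p-prime ∷ _ } =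
  p , p-prime , subst (p ∣_) (sym n≡Π) (m∣m*n (product ps))

n∣n! : ∀ n → 1 ≤ n → n ∣ n !
n∣n! (suc n) _ = m∣m*n (n !)

prime∣n! : ∀ {p n} → Prime p → p ≤ n → p ∣ n !
prime∣n! p-prime p≤n = ∣-trans (n∣n! _ (≤-trans (s≤s z≤n) (prime≥2 p-prime))) (m≤n⇒m!∣n! p≤n)

-- Euclid: a prime factor of N ! + 1 exceeds N, so there are primes above every bound.
primeAbove : ∀ N → ∃ λ p → Prime p × N < p
primeAbove N with primeFactor (N ! + 1) (+-monoˡ-≤ 1 (1≤n! N))
... | p , p-prime , p∣N!+1 with N <? p
... | yes N<p = p , p-prime , N<p
... | no N≮p = ⊥-elim (prime∤1 p-prime (∣m+n∣m⇒∣n p∣N!+1 (prime∣n! p-prime (≮⇒≥ N≮p))))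

prime∤smallFactorial : ∀ {p} → Prime p → ∀ j → j < p → ¬ p ∣ j !
prime∤smallFactorial p-prime zero _ p∣1 = prime∤1 p-prime p∣1
prime∤smallFactorial p-prime (suc j) j<p p∣j! with euclidsLemma (suc j) (j !) p-prime p∣j!
... | inj₁ p∣1+j = <⇒≱ j<p (∣⇒≤ p∣1+j)
... | inj₂ p∣j! = prime∤smallFactorial p-prime j (<-trans (n<1+n j) j<p) p∣j!

prime∣primePower : ∀ {p q} → Prime p → Prime q → ∀ e → p ∣ q ^ e → p ≡ q
prime∣primePower p-prime q-prime zero p∣1 = ⊥-elim (prime∤1 p-prime p∣1)
prime∣primePower {p} {q} p-prime q-prime (suc e) p∣qᵉ⁺¹ with euclidsLemma q (q ^ e) p-prime p∣qᵉ⁺¹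
... | inj₂ p∣qᵉ = prime∣primePower p-prime q-prime e p∣qᵉ
... | inj₁ p∣q with prime⇒irreducible q-prime p∣q
...   | inj₁ p≡1 = ⊥-elim (<⇒≢ (prime≥2 p-prime) (sym p≡1))
...   | inj₂ p≡q = p≡q

module _ {ℓ} {P : Pred ℕ ℓ} (P? : Decidable P) where

  leastWitness : ∀ {w} → P w → ∃ λ x → P x × (∀ y → y < x → ¬ P y)
  leastWitness {w} Pw = [ (λ none → ⊥-elim (none w ≤-refl Pw)) , id ]′ (search (suc w))
    where
    search : ∀ b → (∀ y → y < b → ¬ P y) ⊎ (∃ λ x → P x × (∀ y → y < x → ¬ P y))
    search zero = inj₁ λ y y<0 _ → n≮0 y<0
    search (suc b) with search b | P? b
    ... | inj₂ least | _ = inj₂ least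
    ... | inj₁ none | yes Pb = inj₂ (b , Pb , none)
    ... | inj₁ none | no ¬Pb = inj₁ λ y y<1+b → [ none y , (λ { refl → ¬Pb }) ]′ (m<1+n⇒m<n∨m≡n y<1+b)

  greatestWitness : ∀ {a n} → P a → a ≤ n →
                    ∃ λ x → P x × a ≤ x × x ≤ n × (∀ y → x < y → y ≤ n → ¬ P y)
  greatestWitness {n = zero} Pa z≤n = zero , Pa , z≤n , z≤n , λ y 0<y y≤0 _ → <⇒≱ 0<y y≤0
  greatestWitness {a} {suc n} Pa a≤1+n with P? (suc n) | m≤n⇒m<n∨m≡n a≤1+n
  ... | yes P1+n | _ = suc n , P1+n , a≤1+n , ≤-refl , λ y 1+n<y y≤1+n _ → <⇒≱ 1+n<y y≤1+n
  ... | no ¬P1+n | inj₂ refl = ⊥-elim (¬P1+n Pa)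
  ... | no ¬P1+n | inj₁ a<1+n with greatestWitness Pa (s≤s⁻¹ a<1+n)
  ...   | x , Px , a≤x , x≤n , none = x , Px , a≤x , m≤n⇒m≤1+n x≤n , none′
    where
    none′ : ∀ y → x < y → y ≤ suc n → ¬ P y
    none′ y x<y y≤1+n = [ (λ y<1+n → none y x<y (s≤s⁻¹ y<1+n)) , (λ { refl → ¬P1+n }) ]′
                          (m≤n⇒m<n∨m≡n y≤1+n)

-- Every n beyond a prime a lies in a gap [p, q) between consecutive primes with a ≤ p:
-- p is the greatest prime ≤ n and q the least prime > n.
consecutivePrimesAround : ∀ {a} n → Prime a → a ≤ n →
                          ∃₂ λ p q → ConsecutivePrimes p q × a ≤ p × p ≤ n × n < q
consecutivePrimesAround n a-prime a≤n
  with greatestWitness prime? a-prime a≤n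
     | leastWitness (λ r → (n <? r) ×-dec prime? r) (swap (proj₂ (primeAbove n)))
... | p , p-prime , a≤p , p≤n , noneAbove | q , (n<q , q-prime) , noneBelow =
  p , q , (p-prime , q-prime , ≤-<-trans p≤n n<q , noneBetween) , a≤p , p≤n , n<q
  where
  noneBetween : ∀ r → p < r → r < q → Prime r → ⊥
  noneBetween r p<r r<q r-prime with r ≤? n
  ... | yes r≤n = noneAbove r p<r r≤n r-prime
  ... | no r≰n = noneBelow r r<q (≰⇒> r≰n , r-prime)

cramérGap : ∀ {M N} → (∀ p q → ConsecutivePrimes p q → N ≤ p → q ∸ p ≤ M * (⌈log₂ p ⌉ ^ 2)) →
            ∀ {a} → Prime a → N ≤ a → ∀ n → a ≤ n →
            ∃ λ p → Prime p × p ≤ n × n ∸ p ≤ M * (⌈log₂ n ⌉ ^ 2)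
cramérGap {M} cramér a-prime N≤a n a≤n with consecutivePrimesAround n a-prime a≤n
... | p , q , consecutive@(p-prime , _) , a≤p , p≤n , n<q = p , p-prime , p≤n , (begin
  n ∸ p                 ≤⟨ ∸-monoˡ-≤ p (<⇒≤ n<q) ⟩
  q ∸ p                 ≤⟨ cramér p q consecutive (≤-trans N≤a a≤p) ⟩
  M * (⌈log₂ p ⌉ ^ 2)   ≤⟨ *-monoʳ-≤ M (^-monoˡ-≤ 2 (⌈log₂⌉-mono-≤ p≤n)) ⟩
  M * (⌈log₂ n ⌉ ^ 2)   ∎)
  where open ≤-Reasoning

binomial*factorials : ∀ {n k} → k ≤ n → (n C k) * (k ! * (n ∸ k) !) ≡ n !
binomial*factorials {n} {k} k≤n =
  trans (cong (_* (k ! * (n ∸ k) !)) (nCk≡n!/k![n-k]! k≤n)) (m/n*n≡m (k![n∸k]!∣n! k≤n))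
  where instance _ = k !* (n ∸ k) !≢0

-- The absorption identity (k+1) · C(n+1, k+1) = (n+1) · C(n, k), obtained by
-- multiplying both sides by k! (n-k)! and cancelling.
absorption : ∀ {n k} → k ≤ n → suc k * (suc n C suc k) ≡ suc n * (n C k)
absorption {n} {k} k≤n = *-cancelʳ-≡ _ _ (k ! * (n ∸ k) !) {{k !* (n ∸ k) !≢0}} (begin
  suc k * (suc n C suc k) * (k ! * (n ∸ k) !) ≡⟨ regroup (suc k) (suc n C suc k) (k !) ((n ∸ k) !) ⟩
  (suc n C suc k) * (suc k * k ! * (n ∸ k) !) ≡⟨ binomial*factorials (s≤s k≤n) ⟩
  suc n !                                     ≡⟨ cong (suc n *_) (binomial*factorials k≤n) ⟨
  suc n * ((n C k) * (k ! * (n ∸ k) !))       ≡⟨ *-assoc (suc n) (n C k) _ ⟨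
  suc n * (n C k) * (k ! * (n ∸ k) !)         ∎)
  where
  open ≡-Reasoning
  regroup : ∀ a b c d → a * b * (c * d) ≡ b * (a * c * d)
  regroup = solve-∀

-- A prime p ≤ n divides C(n, k) as soon as both k and n - k are below p:
-- p divides n! but neither k! nor (n-k)!.
largePrime∣binomial : ∀ {p n k} → Prime p → p ≤ n → k ≤ n → k < p → n ∸ k < p → p ∣ n C k
largePrime∣binomial {p} {n} {k} p-prime p≤n k≤n k<p n-k<p
  with euclidsLemma (n C k) (k ! * (n ∸ k) !) p-prime
         (subst (p ∣_) (sym (binomial*factorials k≤n)) (prime∣n! p-prime p≤n))
... | inj₁ p∣C = p∣C
... | inj₂ p∣k![n-k]! with euclidsLemma (k !) ((n ∸ k) !) p-prime p∣k![n-k]!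
...   | inj₁ p∣k! = ⊥-elim (prime∤smallFactorial p-prime k k<p p∣k!)
...   | inj₂ p∣[n-k]! = ⊥-elim (prime∤smallFactorial p-prime (n ∸ k) n-k<p p∣[n-k]!)

primePower∣cancel : ∀ {q} → Prime q → ∀ e k c → q ^ e ∣ k * c → ¬ q ∣ c → q ^ e ∣ k
primePower∣cancel q-prime zero k c _ _ = 1∣ k
primePower∣cancel {q} q-prime (suc e) k c qᵉ⁺¹∣kc q∤c
  with euclidsLemma k c q-prime (∣-trans (m∣m*n (q ^ e)) qᵉ⁺¹∣kc)
... | inj₂ q∣c = ⊥-elim (q∤c q∣c)
... | inj₁ (divides k′ refl) =
  subst (q * q ^ e ∣_) (*-comm q k′) (*-monoʳ-∣ q (primePower∣cancel q-prime e k′ c qᵉ∣k′c q∤c))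
  where
  qᵉ∣k′c : q ^ e ∣ k′ * c
  qᵉ∣k′c = *-cancelˡ-∣ q {{prime⇒nonZero q-prime}}
    (subst (q * q ^ e ∣_) (trans (cong (_* c) (*-comm k′ q)) (*-assoc q k′ c)) qᵉ⁺¹∣kc)

-- If q ^ e ∣ n then q ∣ C(n, k) for every 1 ≤ k < q ^ e: by absorption
-- q ^ e ∣ n · C(n-1, k-1) = k · C(n, k), and q ∤ C(n, k) would force q ^ e ∣ k.
primePower∣binomial : ∀ {q e n k} → Prime q → q ^ e ∣ n → 1 ≤ k → k < q ^ e → k ≤ n → q ∣ n C k
primePower∣binomial {q} {e} {suc n} {suc k} q-prime qᵉ∣n _ k<qᵉ (s≤s k≤n) with q ∣? (suc n C suc k)
... | yes q∣C = q∣C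
... | no q∤C = ⊥-elim (<⇒≱ k<qᵉ (∣⇒≤ (primePower∣cancel q-prime e (suc k) (suc n C suc k)
        (subst (q ^ e ∣_) (sym (absorption k≤n)) (∣-trans qᵉ∣n (m∣m*n (n C k)))) q∤C)))

properIndex<n : ∀ {n k} → 1 ≤ k → k ≤ n ∸ 1 → k < n
properIndex<n {zero} 1≤k k≤0 = ⊥-elim (<⇒≱ 1≤k k≤0)
properIndex<n {suc n} _ k≤n = s≤s k≤n

-- Small k (k ≤ n - p) and, symmetrically, large k (k ≥ p) are caught by q;
-- the middle range n - p < k < p is caught by p.
condition1-criterion : ∀ {p q e n} → Prime p → p ≤ n → Prime q → q ^ e ∣ n → n ∸ p < q ^ e →
                       Condition1 n
condition1-criterion {p} {q} {e} {n} p-prime p≤n q-prime qᵉ∣n gap<qᵉ =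
  p , q , p-prime , q-prime , divisible
  where
  divisible : ∀ k → 1 ≤ k → k ≤ n ∸ 1 → (p ∣ n C k) ⊎ (q ∣ n C k)
  divisible k 1≤k k≤n-1 with properIndex<n 1≤k k≤n-1 | k ≤? n ∸ p | k <? p
  ... | k<n | yes k≤n-p | _ =
    inj₂ (primePower∣binomial {e = e} q-prime qᵉ∣n 1≤k (≤-<-trans k≤n-p gap<qᵉ) (<⇒≤ k<n))
  ... | k<n | no k≰n-p | yes k<p =
    inj₁ (largePrime∣binomial p-prime p≤n (<⇒≤ k<n) k<p n-k<p)
    where
    n<k+p : n < k + p
    n<k+p = subst (_< k + p) (m∸n+n≡m p≤n) (+-monoˡ-< p (≰⇒> k≰n-p))
    n-k<p : n ∸ k < p
    n-k<p = m<n+o⇒m∸n<o n k {{prime⇒nonZero p-prime}} n<k+p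
  ... | k<n | no _ | no k≮p =
    inj₂ (subst (q ∣_) (sym (nCk≡nC[n∸k] (<⇒≤ k<n)))
      (primePower∣binomial {e = e} q-prime qᵉ∣n (m<n⇒0<n∸m k<n)
        (≤-<-trans (∸-monoʳ-≤ n (≮⇒≥ k≮p)) gap<qᵉ) (m∸n≤m n k)))

PrimeDivisor : ℕ → ℕ → Set
PrimeDivisor n p = Prime p × p ∣ n

primeDivisor? : ∀ n p → Dec (PrimeDivisor n p)
primeDivisor? n p = prime? p ×-dec p ∣? n

-- ωBelow n B counts the prime divisors of n below B; ω n is ωBelow n (n + 1).
ωBelow : ℕ → ℕ → ℕ
ωBelow n B = length (filter (primeDivisor? n) (upTo B))

ωBelow-suc : ∀ n B → ωBelow n (suc B) ≡ ωBelow n B + length (filter (primeDivisor? n) [ B ])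
ωBelow-suc n B = begin
  length (F (upTo (suc B)))         ≡⟨ cong (λ xs → length (F xs)) (upTo-∷ʳ B) ⟨
  length (F (upTo B ++ [ B ]))      ≡⟨ cong length (filter-++ (primeDivisor? n) (upTo B) [ B ]) ⟩
  length (F (upTo B) ++ F [ B ])    ≡⟨ length-++ (F (upTo B)) ⟩
  ωBelow n B + length (F [ B ])     ∎
  where
  open ≡-Reasoning
  F = filter (primeDivisor? n)

ωBelow-suc-divisor : ∀ {n B} → PrimeDivisor n B → ωBelow n (suc B) ≡ suc (ωBelow n B)
ωBelow-suc-divisor {n} {B} B∣n = trans (ωBelow-suc n B)
  (trans (cong (λ xs → ωBelow n B + length xs) (filter-accept (primeDivisor? n) B∣n)) (+-comm _ 1))

ωBelow-suc-nondivisor : ∀ {n B} → ¬ PrimeDivisor n B → ωBelow n (suc B) ≡ ωBelow n B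
ωBelow-suc-nondivisor {n} {B} B∤n = trans (ωBelow-suc n B)
  (trans (cong (λ xs → ωBelow n B + length xs) (filter-reject (primeDivisor? n) B∤n)) (+-identityʳ _))

ωBelow-cong : ∀ {n n′} B → (∀ p → p < B → PrimeDivisor n p → PrimeDivisor n′ p) →
              (∀ p → p < B → PrimeDivisor n′ p → PrimeDivisor n p) → ωBelow n B ≡ ωBelow n′ B
ωBelow-cong zero _ _ = refl
ωBelow-cong {n} {n′} (suc B) to from =
  extend (primeDivisor? n B) (ωBelow-cong B (λ p p<B → to p (m<n⇒m<1+n p<B))
                                             (λ p p<B → from p (m<n⇒m<1+n p<B)))
  where
  extend : Dec (PrimeDivisor n B) → ωBelow n B ≡ ωBelow n′ B → ωBelow n (suc B) ≡ ωBelow n′ (suc B)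
  extend (yes B∣n) same = trans (ωBelow-suc-divisor B∣n)
    (trans (cong suc same) (sym (ωBelow-suc-divisor (to B (n<1+n B) B∣n))))
  extend (no B∤n) same = trans (ωBelow-suc-nondivisor B∤n)
    (trans same (sym (ωBelow-suc-nondivisor λ B∣n′ → B∤n (from B (n<1+n B) B∣n′))))

primePowerSplit : ∀ {p} → Prime p → ∀ n → 1 ≤ n → ∃₂ λ e m → n ≡ p ^ e * m × ¬ p ∣ m
primePowerSplit {p} p-prime n 1≤n = split n 1≤n (<-wellFounded n)
  where
  split : ∀ n → 1 ≤ n → Acc _<_ n → ∃₂ λ e m → n ≡ p ^ e * m × ¬ p ∣ m
  split n 1≤n (acc smaller) with p ∣? n
  ... | no p∤n = 0 , n , sym (+-identityʳ n) , p∤n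
  ... | yes (divides n′ n≡n′p) with split n′ 1≤n′ (smaller n′<n)
    where
    1≤n′ : 1 ≤ n′
    1≤n′ = n≢0⇒n>0 λ { refl → <⇒≢ 1≤n (sym n≡n′p) }
    n′<n : n′ < n
    n′<n = subst (n′ <_) (sym n≡n′p) (m<m*n n′ p {{>-nonZero 1≤n′}} (prime≥2 p-prime))
  ...   | e , m , n′≡pᵉm , p∤m = suc e , m , n≡pᵉ⁺¹m , p∤m
    where
    open ≡-Reasoning
    n≡pᵉ⁺¹m : n ≡ p ^ suc e * m
    n≡pᵉ⁺¹m = begin
      n               ≡⟨ n≡n′p ⟩
      n′ * p          ≡⟨ *-comm n′ p ⟩
      p * n′          ≡⟨ cong (p *_) n′≡pᵉm ⟩
      p * (p ^ e * m) ≡⟨ *-assoc p (p ^ e) m ⟨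
      p ^ suc e * m   ∎

ωBelow-cofactor : ∀ {B e n m} → Prime B → n ≡ B ^ e * m → ωBelow m B ≡ ωBelow n B
ωBelow-cofactor {B} {e} {n} {m} B-prime n≡Bᵉm = ωBelow-cong B inward outward
  where
  m∣n : m ∣ n
  m∣n = divides (B ^ e) n≡Bᵉm
  inward : ∀ p → p < B → PrimeDivisor m p → PrimeDivisor n p
  inward p _ (p-prime , p∣m) = p-prime , ∣-trans p∣m m∣n
  outward : ∀ p → p < B → PrimeDivisor n p → PrimeDivisor m p
  outward p p<B (p-prime , p∣n) with euclidsLemma (B ^ e) m p-prime (subst (p ∣_) n≡Bᵉm p∣n)
  ... | inj₂ p∣m = p-prime , p∣m
  ... | inj₁ p∣Bᵉ = ⊥-elim (<⇒≢ p<B (prime∣primePower p-prime B-prime e p∣Bᵉ))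

LargePrimePowerDivisor : ℕ → ℕ → Set
LargePrimePowerDivisor G n = ∃₂ λ q e → Prime q × q ^ e ∣ n × G < q ^ e

-- Induction on a bound B for the prime divisors: the full power
-- of the top prime B is at most G, and the cofactor has the same smaller primes.
primePowers≤⇒bounded : ∀ G B n → 1 ≤ n → (∀ p → PrimeDivisor n p → p < B) →
                        LargePrimePowerDivisor G n ⊎ n ≤ G ^ ωBelow n B
primePowers≤⇒bounded G zero n 1≤n below with n ≤? 1
... | yes n≤1 = inj₂ n≤1
... | no n≰1 with primeFactor n (≰⇒> n≰1)
...   | p , p∣n = ⊥-elim (n≮0 (below p p∣n))
primePowers≤⇒bounded G (suc B) n 1≤n below with primeDivisor? n B
... | no B∤n = subst (λ c → LargePrimePowerDivisor G n ⊎ n ≤ G ^ c) (sym (ωBelow-suc-nondivisor B∤n))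
                 (primePowers≤⇒bounded G B n 1≤n below′)
  where
  below′ : ∀ p → PrimeDivisor n p → p < B
  below′ p p∣n = ≤∧≢⇒< (s≤s⁻¹ (below p p∣n)) λ { refl → B∤n p∣n }
... | yes B∣n@(B-prime , _) with primePowerSplit B-prime n 1≤n
...   | e , m , n≡Bᵉm , B∤m with B ^ e ≤? G
...     | no Bᵉ≰G = inj₁ (B , e , B-prime , divides m (trans n≡Bᵉm (*-comm (B ^ e) m)) , ≰⇒> Bᵉ≰G)
...     | yes Bᵉ≤G with primePowers≤⇒bounded G B m 1≤m below′
  where
  m∣n : m ∣ n
  m∣n = divides (B ^ e) n≡Bᵉm
  1≤m : 1 ≤ m
  1≤m = n≢0⇒n>0 λ { refl → <⇒≢ 1≤n (sym (trans n≡Bᵉm (*-zeroʳ (B ^ e)))) }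
  below′ : ∀ p → PrimeDivisor m p → p < B
  below′ p (p-prime , p∣m) =
    ≤∧≢⇒< (s≤s⁻¹ (below p (p-prime , ∣-trans p∣m m∣n))) λ { refl → B∤m p∣m }
...       | inj₁ (q , f , q-prime , qᶠ∣m , G<qᶠ) =
  inj₁ (q , f , q-prime , ∣-trans qᶠ∣m (divides (B ^ e) n≡Bᵉm) , G<qᶠ)
...       | inj₂ m≤Gᵏ = inj₂ (begin
  n                        ≡⟨ n≡Bᵉm ⟩
  B ^ e * m                ≤⟨ *-mono-≤ Bᵉ≤G m≤Gᵏ ⟩
  G * G ^ ωBelow m B       ≡⟨ cong (λ c → G * G ^ c) (ωBelow-cofactor {e = e} B-prime n≡Bᵉm) ⟩
  G ^ suc (ωBelow n B)     ≡⟨ cong (G ^_) (ωBelow-suc-divisor B∣n) ⟨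
  G ^ ωBelow n (suc B)     ∎)
  where open ≤-Reasoning

largePrimePowerDivisor : ∀ G n → G ^ ω n < n → LargePrimePowerDivisor G n
largePrimePowerDivisor G n Gʷ<n with primePowers≤⇒bounded G (suc n) n 1≤n divisor≤n
  where
  1≤n : 1 ≤ n
  1≤n = ≤-trans (s≤s z≤n) Gʷ<n
  divisor≤n : ∀ p → PrimeDivisor n p → p < suc n
  divisor≤n p (_ , p∣n) = s≤s (∣⇒≤ {{>-nonZero 1≤n}} p∣n)
... | inj₁ large = large
... | inj₂ n≤Gʷ = ⊥-elim (<⇒≱ Gʷ<n n≤Gʷ)

n<b^n : ∀ b → 2 ≤ b → ∀ n → n < b ^ n
n<b^n b 2≤b zero = s≤s z≤n
n<b^n b 2≤b (suc n) = begin-strict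
  suc n           ≤⟨ n<b^n b 2≤b n ⟩
  b ^ n           <⟨ m<m+n (b ^ n) (≤-trans (s≤s z≤n) (n<b^n b 2≤b n)) ⟩
  b ^ n + b ^ n   ≡⟨ cong (b ^ n +_) (+-identityʳ (b ^ n)) ⟨
  2 * b ^ n       ≤⟨ *-monoˡ-≤ (b ^ n) 2≤b ⟩
  b ^ suc n       ∎
  where open ≤-Reasoning

-- Magnitude in base b: every n ≥ 2 satisfies b ^ s < n ≤ b ^ (s + 1) for some s,
-- namely s + 1 the least exponent t with n ≤ b ^ t.
magnitude : ∀ b → 2 ≤ b → ∀ n → 2 ≤ n → ∃ λ s → b ^ s < n × n ≤ b ^ suc s
magnitude b 2≤b n 2≤n with leastWitness (λ t → n ≤? b ^ t) {w = n} (<⇒≤ (n<b^n b 2≤b n))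
... | zero , n≤1 , _ = ⊥-elim (<⇒≱ 2≤n n≤1)
... | suc s , n≤b^[s+1] , smaller = s , ≰⇒> (smaller s ≤-refl) , n≤b^[s+1]

square≤2^ : ∀ s → 4 ≤ s → s * s ≤ 2 ^ s
square≤2^ s 4≤s with m≤n⇒∃[o]m+o≡n 4≤s
... | t , refl = go t
  where
  step : ∀ t → (5 + t) * (5 + t) ≤ 2 * ((4 + t) * (4 + t))
  step t = subst ((5 + t) * (5 + t) ≤_) (identity t) (m≤m+n _ _)
    where
    identity : ∀ t → (5 + t) * (5 + t) + (7 + 6 * t + t * t) ≡ 2 * ((4 + t) * (4 + t))
    identity = solve-∀
  go : ∀ t → (4 + t) * (4 + t) ≤ 2 ^ (4 + t)
  go zero = ≤-refl
  go (suc t) = ≤-trans (step t) (*-monoʳ-≤ 2 (go t))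

-- The quantitative heart of "polylog ≪ n": once s ≥ 4m(M+1) + 4 and L ≤ 2m(s+1),
-- (M L²)^m ≤ (2^(2m))^s. Indeed (M+1) L ≤ (M+1)·4m·s ≤ s² ≤ 2^s, so M L² ≤ (2^s)².
polylog^m≤ : ∀ M m s L → suc M * (4 * m) + 4 ≤ s → L ≤ 2 * m * suc s →
             (M * L ^ 2) ^ m ≤ (2 ^ (2 * m)) ^ s
polylog^m≤ M m s L s-large L≤ = begin
  (M * L ^ 2) ^ m         ≤⟨ ^-monoˡ-≤ m (≤-trans M*L²≤[AL]² (^-monoˡ-≤ 2 AL≤2^s)) ⟩
  ((2 ^ s) ^ 2) ^ m       ≡⟨ trans (cong (_^ m) (^-*-assoc 2 s 2)) (^-*-assoc 2 (s * 2) m) ⟩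
  2 ^ (s * 2 * m)         ≡⟨ cong (2 ^_) (exponents s m) ⟩
  2 ^ (2 * m * s)         ≡⟨ ^-*-assoc 2 (2 * m) s ⟨
  (2 ^ (2 * m)) ^ s       ∎
  where
  open ≤-Reasoning
  A = suc M
  1≤s : 1 ≤ s
  1≤s = ≤-trans (s≤s z≤n) (m+n≤o⇒n≤o (A * (4 * m)) s-large)
  exponents : ∀ s m → s * 2 * m ≡ 2 * m * s
  exponents = solve-∀
  split : ∀ m s → 2 * m * suc s ≡ 2 * m + 2 * m * s
  split = solve-∀
  double : ∀ m s → 2 * m * s + 2 * m * s ≡ 4 * m * s
  double = solve-∀
  L≤4ms : L ≤ 4 * m * s
  L≤4ms = begin
    L                       ≤⟨ L≤ ⟩
    2 * m * suc s           ≡⟨ split m s ⟩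
    2 * m + 2 * m * s       ≤⟨ +-monoˡ-≤ (2 * m * s) (m≤m*n (2 * m) s {{>-nonZero 1≤s}}) ⟩
    2 * m * s + 2 * m * s   ≡⟨ double m s ⟩
    4 * m * s               ∎
  AL≤2^s : A * L ≤ 2 ^ s
  AL≤2^s = begin
    A * L             ≤⟨ *-monoʳ-≤ A L≤4ms ⟩
    A * (4 * m * s)   ≡⟨ *-assoc A (4 * m) s ⟨
    A * (4 * m) * s   ≤⟨ *-monoˡ-≤ s (m+n≤o⇒m≤o (A * (4 * m)) s-large) ⟩
    s * s             ≤⟨ square≤2^ s (m+n≤o⇒n≤o (A * (4 * m)) s-large) ⟩
    2 ^ s             ∎
  M*L²≤[AL]² : M * L ^ 2 ≤ (A * L) ^ 2
  M*L²≤[AL]² = subst (M * L ^ 2 ≤_) (square-product A L) (*-monoˡ-≤ (L ^ 2) (≤-trans (n≤1+n M) (m≤m*n A A)))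
    where
    square-product : ∀ a l → a * a * (l * (l * 1)) ≡ (a * l) * ((a * l) * 1)
    square-product = solve-∀

-- (M ⌈log₂ n⌉²)^m < n for all large n. With b = 2^(2m) and b^s < n ≤ b^(s+1):
-- n ≥ b^S + 2 forces s ≥ S, and ⌈log₂ n⌉ ≤ 2m(s+1), so the previous bound gives
-- (M ⌈log₂ n⌉²)^m ≤ b^s < n.
polylog^m<n-eventually : ∀ M m → 1 ≤ m →
                          ∃ λ n₀ → ∀ n → n₀ ≤ n → (M * (⌈log₂ n ⌉ ^ 2)) ^ m < n
polylog^m<n-eventually M m 1≤m = b ^ S + 2 , bound
  where
  b = 2 ^ (2 * m)
  S = suc M * (4 * m) + 4
  2≤b : 2 ≤ b
  2≤b = ^-monoʳ-≤ 2 (≤-trans 1≤m (m≤n*m m 2))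
  instance
    b≢0 : NonZero b
    b≢0 = >-nonZero (≤-trans (s≤s z≤n) 2≤b)
  bound : ∀ n → b ^ S + 2 ≤ n → (M * (⌈log₂ n ⌉ ^ 2)) ^ m < n
  bound n n₀≤n with magnitude b 2≤b n (m+n≤o⇒n≤o (b ^ S) n₀≤n)
  ... | s , b^s<n , n≤b^[s+1] = ≤-<-trans (polylog^m≤ M m s ⌈log₂ n ⌉ S≤s log≤) b^s<n
    where
    b^S<n : b ^ S < n
    b^S<n = <-≤-trans (m<m+n (b ^ S) (s≤s z≤n)) n₀≤n
    S≤s : S ≤ s
    S≤s with S ≤? s
    ... | yes S≤s = S≤s
    ... | no S≰s = ⊥-elim (<⇒≱ b^S<n (≤-trans n≤b^[s+1] (^-monoʳ-≤ b (≰⇒> S≰s))))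
    log≤ : ⌈log₂ n ⌉ ≤ 2 * m * suc s
    log≤ = ≤-trans (⌈log₂⌉-mono-≤ n≤b^[s+1])
             (≤-reflexive (trans (cong ⌈log₂_⌉ (^-*-assoc 2 (2 * m) (suc s))) (⌈log₂2^n⌉≡n (2 * m * suc s))))

-- Take n₀ beyond a prime a > N and beyond the point where G ^ m < n.
proposition5p3 : CramerConjecture → (m : ℕ) → 1 ≤ m → ∃ λ (n₀ : ℕ) → ∀ (n : ℕ) → n₀ ≤ n → ω n ≡ m → Condition1 n
proposition5p3 (M , N , cramér) m 1≤m =
  let (a , a-prime , N<a) = primeAbove N
      (n₁ , polylog^m<n) = polylog^m<n-eventually M m 1≤m
  in a + n₁ , λ n n₀≤n ωn≡m →
  let G = M * (⌈log₂ n ⌉ ^ 2)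
      (p , p-prime , p≤n , n-p≤G) = cramérGap {M = M} cramér a-prime (<⇒≤ N<a) n (m+n≤o⇒m≤o a n₀≤n)
      (q , e , q-prime , qᵉ∣n , G<qᵉ) = largePrimePowerDivisor G n
          (subst (λ k → G ^ k < n) (sym ωn≡m) (polylog^m<n n (m+n≤o⇒n≤o a n₀≤n)))
  in condition1-criterion {e = e} p-prime p≤n q-prime qᵉ∣n (≤-<-trans n-p≤G G<qᵉ)
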